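{- Let $\Sigma=\{a\}$ be a unary alphabet. For every $n\geq 2$ there exist a DFA $\mathcal{A}_n$ over $\Sigma$ and a language $L_n\subseteq\Sigma^*$ such that $\mathcal{A}_n\in\mathsf{Rec}(L_n,n)$, $\mathcal{A}_n$ is $\mathsf{Rec}(L_n,n)$-minimal with respect to $\prec_{2n-3}$, but $\mathcal{A}_n$ is not $\mathsf{Rec}(L_n,n)$-minimal with respect to $\prec_{\mathcal{L}}$.
   Context: A DFA over $\Sigma$ is a tuple $(Q,\Sigma,q_{\mathsf{init}},\delta,F)$ with finite non-empty state set, total transition function $\delta\colon Q\times\Sigma\to Q$ and accepting set $F$; $\mathcal{L}(\mathcal{A})$ is its language. $\mathsf{Rec}(L,n)$ is the set of DFAs over $\Sigma$ with at most $n$ states whose language contains $L$. For DFAs $\mathcal{A},\mathcal{A}'$: $\mathcal{A}\prec_{\mathcal{L}}\mathcal{A}'$ iff $\mathcal{L}(\mathcal{A})\subsetneq\mathcal{L}(\mathcal{A}')$; for $h\in\mathbb{N}$, $\mathcal{A}\prec_h\mathcal{A}'$ iff $|\mathcal{L}(\mathcal{A})\cap\Sigma^{\leq h}|<|\mathcal{L}(\mathcal{A}')\cap\Sigma^{\leq h}|$, with $\Sigma^{\leq h}$ the words of length at most $h$. For a set $S$ of DFAs, $\mathcal{A}\in S$ is $S$-minimal w.r.t. $\prec$ if no $\mathcal{A}'\in S$ satisfies $\mathcal{A}'\prec\mathcal{A}$. -}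

module Defs where

open import Data.Nat using (ℕ; zero; suc; _≤_; _<_)
open import Data.Fin using (Fin)
open import Data.Bool using (Bool; true; false)
open import Data.Unit using (⊤; tt)
open import Data.List using (List; []; _∷_; length; filter; map; upTo; replicate)
open import Data.Product using (Σ; _×_; ∃-syntax)
open import Relation.Nullary using (¬_)
open import Relation.Binary.PropositionalEquality using (_≡_)
open import Data.Bool.Properties using (T?)
open import Data.Bool using (T)

Letter : Set
Letter = ⊤

a : Letter
a = tt

Word : Set
Word = List Letter

Language : Set₁
Language = Word → Set

record DFA : Set where
  field
    m      : ℕ
    init   : Fin (suc m)
    δ      : Fin (suc m) → Letter → Fin (suc m)
    accept : Fin (suc m) → Bool

  #states : ℕ
  #states = suc m

  run : Fin (suc m) → Word → Fin (suc m)
  run q []       = q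
  run q (x ∷ w)  = run (δ q x) w

  accepts : Word → Bool
  accepts w = accept (run init w)

open DFA public

_∈ℒ_ : Word → DFA → Set
w ∈ℒ A = accepts A w ≡ true

Rec : Language → ℕ → DFA → Set
Rec L n A = (#states A ≤ n) × (∀ w → L w → w ∈ℒ A)

wordsUpTo : ℕ → List Word
wordsUpTo h = map (λ i → replicate i a) (upTo (suc h))

count : ℕ → DFA → ℕ
count h A = length (filter (λ w → T? (accepts A w)) (wordsUpTo h))

_≺ℒ_ : DFA → DFA → Set
A ≺ℒ A' = (∀ w → w ∈ℒ A → w ∈ℒ A') × (∃[ w ] (w ∈ℒ A' × ¬ (w ∈ℒ A)))

_≺[_]_ : DFA → ℕ → DFA → Set
A ≺[ h ] A' = count h A < count h A'

Minimal : (DFA → Set) → (DFA → DFA → Set) → DFA → Set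
Minimal S _≺_ A = S A × (∀ A' → S A' → ¬ (A' ≺ A))

{-# OPTIONS --safe #-}
-- For n = k + 2 take A the chain 0 → 1 → ⋯ → k+1 (looping at k+1) rejecting only state k,
-- so L(A) = Σ* ∖ {a^k}, and L = L(B) for the cycle B of length n rejecting state k, i.e. the
-- words a^ℓ with ℓ mod n ≠ k. B has n states and L(B) ⊊ L(A), the word a^(k+n) separating
-- them, so A is not ≺ℒ-minimal. But A and B agree on all words shorter than k + n = 2n − 2,
-- so every DFA containing L accepts at least as many words of length ≤ 2n − 3 as A does.
module Submission where

open import Defs
open import Data.Bool using (Bool; true; false; not)
open import Data.Bool.Properties using (T?)
open import Data.Fin using (toℕ; fromℕ<) renaming (zero to fzero)
open import Data.Fin.Properties using (toℕ-fromℕ<)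
open import Data.List using (List; []; _∷_; length; filter; replicate)
open import Data.List.Relation.Unary.All using (All; []; _∷_)
open import Data.List.Relation.Unary.All.Properties using (map⁺; applyUpTo⁺₁)
open import Data.Nat using (ℕ; zero; suc; _≤_; _<_; _+_; _*_; _∸_; _⊓_; _%_; _/_; _≟_; s≤s; s≤s⁻¹; z≤n; NonZero)
open import Data.Nat.DivMod using (m≡m%n+[m/n]*n; m%n<n; m%n%n≡m%n; %-distribˡ-+; m≤n⇒m%n≡m; [m+n]%n≡m%n)
open import Data.Nat.Properties
open import Data.Product using (Σ; _×_; _,_)
open import Function using (id; _∘_; _⇔_; mk⇔; Equivalence)
open import Relation.Nullary using (¬_; yes; no; contradiction)
open import Relation.Nullary.Decidable using (⌊_⌋)
open import Relation.Binary.PropositionalEquality using (_≡_; _≢_; refl; sym; trans; cong; subst; module ≡-Reasoning)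

length-filter-mono : {A : Set} (p q : A → Bool) (xs : List A) →
  All (λ x → p x ≡ true → q x ≡ true) xs →
  length (filter (T? ∘ p) xs) ≤ length (filter (T? ∘ q) xs)
length-filter-mono p q []       []         = z≤n
length-filter-mono p q (x ∷ xs) (px⇒qx ∷ ps) with p x | q x | px⇒qx
... | true  | true  | _     = s≤s (length-filter-mono p q xs ps)
... | true  | false | p⇒q   = contradiction (p⇒q refl) λ ()
... | false | true  | _     = m≤n⇒m≤1+n (length-filter-mono p q xs ps)
... | false | false | _     = length-filter-mono p q xs ps

m%n≡o⇒m<o+n⇒m≡o : ∀ m n {o} .{{_ : NonZero n}} → m % n ≡ o → m < o + n → m ≡ o
m%n≡o⇒m<o+n⇒m≡o m n {o} m%n≡o m<o+n with m / n | m≡m%n+[m/n]*n m n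
... | zero  | m≡ = trans m≡ (trans (+-identityʳ (m % n)) m%n≡o)
... | suc q | m≡ = contradiction o+n≤m (<⇒≱ m<o+n)
  where
    open ≤-Reasoning
    o+n≤m : o + n ≤ m
    o+n≤m = begin
      o + n             ≡⟨ cong (_+ n) m%n≡o ⟨
      m % n + n         ≤⟨ +-monoʳ-≤ (m % n) (m≤m+n n (q * n)) ⟩
      m % n + suc q * n ≡⟨ m≡ ⟨
      m                 ∎

[1+m%n]%n≡[1+m]%n : ∀ m n .{{_ : NonZero n}} → suc (m % n) % n ≡ suc m % n
[1+m%n]%n≡[1+m]%n m n = begin
  (1 + m % n) % n         ≡⟨ %-distribˡ-+ 1 (m % n) n ⟩
  (1 % n + m % n % n) % n ≡⟨ cong (λ x → (1 % n + x) % n) (m%n%n≡m%n m n) ⟩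
  (1 % n + m % n) % n     ≡⟨ %-distribˡ-+ 1 m n ⟨
  (1 + m) % n             ∎
  where open ≡-Reasoning

suc[m⊓n]⊓n≡suc[m]⊓n : ∀ m n → suc (m ⊓ n) ⊓ n ≡ suc m ⊓ n
suc[m⊓n]⊓n≡suc[m]⊓n m n = trans (⊓-assoc (suc m) (suc n) n) (cong (suc m ⊓_) (m≥n⇒m⊓n≡n (n≤1+n n)))

m⊓suc[n]≡n⇒m≡n : ∀ m n → m ⊓ suc n ≡ n → m ≡ n
m⊓suc[n]≡n⇒m≡n zero    n       eq = eq
m⊓suc[n]≡n⇒m≡n (suc m) (suc n) eq = cong suc (m⊓suc[n]≡n⇒m≡n m n (suc-injective eq))

2*[2+k]∸3≡k+[1+k] : ∀ k → 2 * (2 + k) ∸ 3 ≡ k + suc k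
2*[2+k]∸3≡k+[1+k] k rewrite +-identityʳ k | +-suc k (suc k) = refl

_≢ᵇ_ : ℕ → ℕ → Bool
i ≢ᵇ r = not ⌊ i ≟ r ⌋

≢ᵇ-true⇔≢ : ∀ i r → i ≢ᵇ r ≡ true ⇔ i ≢ r
≢ᵇ-true⇔≢ i r with i ≟ r
... | yes i≡r = mk⇔ (λ ()) (contradiction i≡r)
... | no  i≢r = mk⇔ (λ _ → i≢r) (λ _ → refl)

infix 25 a^_
a^_ : ℕ → Word
a^ ℓ = replicate ℓ a

w≡a^length[w] : ∀ w → w ≡ a^ length w
w≡a^length[w] []      = refl
w≡a^length[w] (_ ∷ w) = cong (a ∷_) (w≡a^length[w] w)

run-a^suc : ∀ D q ℓ → run D q (a^ suc ℓ) ≡ δ D (run D q (a^ ℓ)) a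
run-a^suc D q zero    = refl
run-a^suc D q (suc ℓ) = run-a^suc D (δ D q a) ℓ

count-mono : ∀ h A B → (∀ ℓ → ℓ ≤ h → a^ ℓ ∈ℒ A → a^ ℓ ∈ℒ B) → count h A ≤ count h B
count-mono h A B A⊆B = length-filter-mono (accepts A) (accepts B) (wordsUpTo h)
  (map⁺ (applyUpTo⁺₁ id (suc h) λ ℓ<1+h → A⊆B _ (s≤s⁻¹ ℓ<1+h)))

unaryDFA : (m : ℕ) (next : ℕ → ℕ) → (∀ i → next i < suc m) → (ℕ → Bool) → DFA
unaryDFA m next next<1+m final = record
  { m = m ; init = fzero ; δ = λ q _ → fromℕ< (next<1+m (toℕ q)) ; accept = final ∘ toℕ }

module _ {m : ℕ} {next : ℕ → ℕ} (next<1+m : ∀ i → next i < suc m) (r : ℕ)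
         (pos : ℕ → ℕ) (pos-zero : pos 0 ≡ 0) (pos-suc : ∀ ℓ → next (pos ℓ) ≡ pos (suc ℓ)) where

  private
    D : DFA
    D = unaryDFA m next next<1+m (_≢ᵇ r)

  toℕ-run-unaryDFA : ∀ ℓ → toℕ (run D fzero (a^ ℓ)) ≡ pos ℓ
  toℕ-run-unaryDFA zero    = sym pos-zero
  toℕ-run-unaryDFA (suc ℓ) = begin
    toℕ (run D fzero (a^ suc ℓ))                        ≡⟨ cong toℕ (run-a^suc D fzero ℓ) ⟩
    toℕ (fromℕ< (next<1+m (toℕ (run D fzero (a^ ℓ))))) ≡⟨ toℕ-fromℕ< _ ⟩
    next (toℕ (run D fzero (a^ ℓ)))                     ≡⟨ cong next (toℕ-run-unaryDFA ℓ) ⟩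
    next (pos ℓ)                                        ≡⟨ pos-suc ℓ ⟩
    pos (suc ℓ)                                         ∎
    where open ≡-Reasoning

  a^∈unaryDFA⇔ : ∀ ℓ → a^ ℓ ∈ℒ D ⇔ pos ℓ ≢ r
  a^∈unaryDFA⇔ ℓ = subst (λ i → i ≢ᵇ r ≡ true ⇔ pos ℓ ≢ r) (sym (toℕ-run-unaryDFA ℓ)) (≢ᵇ-true⇔≢ (pos ℓ) r)

allButDFA : ℕ → DFA
allButDFA r = unaryDFA (suc r) (λ i → suc i ⊓ suc r) (λ i → s≤s (m⊓n≤n (suc i) (suc r))) (_≢ᵇ r)

cycleDFA : ℕ → ℕ → DFA
cycleDFA m r = unaryDFA m (λ i → suc i % suc m) (λ i → m%n<n (suc i) (suc m)) (_≢ᵇ r)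

a^∈allButDFA⇔ : ∀ r ℓ → a^ ℓ ∈ℒ allButDFA r ⇔ ℓ ≢ r
a^∈allButDFA⇔ r ℓ = mk⇔
  (λ a^ℓ∈A ℓ≡r → to a^ℓ∈A (subst (λ j → j ⊓ suc r ≡ r) (sym ℓ≡r) (m≤n⇒m⊓n≡m (n≤1+n r))))
  (λ ℓ≢r → from (ℓ≢r ∘ m⊓suc[n]≡n⇒m≡n ℓ r))
  where
    open Equivalence (a^∈unaryDFA⇔ (λ i → s≤s (m⊓n≤n (suc i) (suc r))) r (_⊓ suc r) refl
      (λ j → suc[m⊓n]⊓n≡suc[m]⊓n j (suc r)) ℓ)

a^∈cycleDFA⇔ : ∀ m r ℓ → a^ ℓ ∈ℒ cycleDFA m r ⇔ ℓ % suc m ≢ r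
a^∈cycleDFA⇔ m r = a^∈unaryDFA⇔ (λ i → m%n<n (suc i) (suc m)) r (_% suc m) refl
  (λ j → [1+m%n]%n≡[1+m]%n j (suc m))

cycleDFA⊆allButDFA : ∀ {m r} → r ≤ m → ∀ w → w ∈ℒ cycleDFA m r → w ∈ℒ allButDFA r
cycleDFA⊆allButDFA {m} {r} r≤m w w∈C rewrite w≡a^length[w] w =
  Equivalence.from (a^∈allButDFA⇔ r (length w)) λ ℓ≡r →
    Equivalence.to (a^∈cycleDFA⇔ m r (length w)) w∈C (trans (cong (_% suc m) ℓ≡r) (m≤n⇒m%n≡m r≤m))

allButDFA⊆cycleDFA-below : ∀ {m r ℓ} → ℓ ≤ r + m → a^ ℓ ∈ℒ allButDFA r → a^ ℓ ∈ℒ cycleDFA m r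
allButDFA⊆cycleDFA-below {m} {r} {ℓ} ℓ≤r+m a^ℓ∈A =
  Equivalence.from (a^∈cycleDFA⇔ m r ℓ) λ ℓ%≡r →
    Equivalence.to (a^∈allButDFA⇔ r ℓ) a^ℓ∈A
      (m%n≡o⇒m<o+n⇒m≡o ℓ (suc m) ℓ%≡r (≤-<-trans ℓ≤r+m (+-monoʳ-< r (n<1+n m))))

cycleDFA≺ℒallButDFA : ∀ {m r} → r ≤ m → cycleDFA m r ≺ℒ allButDFA r
cycleDFA≺ℒallButDFA {m} {r} r≤m = cycleDFA⊆allButDFA r≤m , a^ (r + suc m) ,
  Equivalence.from (a^∈allButDFA⇔ r (r + suc m)) (m+1+n≢m r) ,
  λ a^∈C → Equivalence.to (a^∈cycleDFA⇔ m r (r + suc m)) a^∈C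
             (trans ([m+n]%n≡m%n r (suc m)) (m≤n⇒m%n≡m r≤m))

mainTheorem6 : (n : ℕ) → 2 ≤ n →
    Σ DFA λ A → Σ Language λ L →
      Rec L n A
      × Minimal (Rec L n) (λ B C → B ≺[ 2 * n ∸ 3 ] C) A
      × ¬ Minimal (Rec L n) _≺ℒ_ A
mainTheorem6 (suc (suc k)) (s≤s (s≤s z≤n)) =
  A , L , A∈Rec , (A∈Rec , A-≺h-minimal) , λ (_ , A-≺ℒ-minimal) →
    A-≺ℒ-minimal B (≤-refl , λ _ w∈B → w∈B) (cycleDFA≺ℒallButDFA (n≤1+n k))
  where
    A B : DFA
    A = allButDFA k
    B = cycleDFA (suc k) k
    L : Language
    L = _∈ℒ B
    A∈Rec : Rec L (2 + k) A
    A∈Rec = ≤-refl , cycleDFA⊆allButDFA (n≤1+n k)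
    A-≺h-minimal : ∀ C → Rec L (2 + k) C → ¬ C ≺[ 2 * (2 + k) ∸ 3 ] A
    A-≺h-minimal C (_ , L⊆C) C≺A = <⇒≱ C≺A (count-mono _ A C λ ℓ ℓ≤h a^ℓ∈A →
      L⊆C (a^ ℓ) (allButDFA⊆cycleDFA-below (subst (ℓ ≤_) (2*[2+k]∸3≡k+[1+k] k) ℓ≤h) a^ℓ∈A))
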